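{- Let $S$ be a finite nonempty set, $B$ the nonempty integral base-polyhedron defined by an integer-valued supermodular function $p$, $\dot B=B\cap\mathbb{Z}^S$, and $\hat p$ the linear extension of $p$. For an integer vector $c\in\mathbb{Z}^S$ with $c(s)\ge1$ for every $s\in S$, $$\min\Big\{\sum_{s\in S}c(s)x(s)^2 : x\in\dot B\Big\}=\max\Big\{\hat p(\pi)-\sum_{s\in S}\Big\lfloor\tfrac12\Big(\tfrac{\pi(s)}{c(s)}+1\Big)\Big\rfloor\Big(\pi(s)-c(s)\Big\lfloor\tfrac12\Big(\tfrac{\pi(s)}{c(s)}+1\Big)\Big\rfloor\Big) : \pi\in\mathbb{Z}^S\Big\}.$$
   Context: $p:2^S\to\mathbb{Z}\cup\{ -\infty\}$ is supermodular ($p(X)+p(Y)\le p(X\cap Y)+p(X\cup Y)$ when the left terms are finite) with $p(\emptyset)=0$, $p(S)$ finite; $B=\{x\in\mathbb{R}^S:\widetilde x(S)=p(S),\ \widetilde x(Z)\ge p(Z)\ \forall Z\subset S\}$ where $\widetilde x(Z)=\sum_{v\in Z}x(v)$. The linear (Lovász) extension is $\hat p(\pi)=p(I_n)\pi(s_n)+\sum_{j=1}^{n-1}p(I_j)[\pi(s_j)-\pi(s_{j+1})]$ with $n=|S|$, $\pi(s_1)\ge\dots\ge\pi(s_n)$, $I_j=\{s_1,\dots,s_j\}$; it equals $\min\{\langle\pi,x\rangle:x\in\dot B\}$ (possibly $-\infty$). The maximum is understood as a supremum. -}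

module Defs where

open import Data.Nat as ℕ using (ℕ; zero; suc)
open import Data.Integer as ℤ using (ℤ; +_; _+_; _-_; _*_; _≤_; _≤?_; _/ℕ_; ∣_∣)
open import Data.Fin using (Fin; zero; suc)
open import Data.Fin.Subset using (Subset; _∩_; _∪_; ⁅_⁆; ⊥; ⊤)
open import Data.Vec using (lookup)
open import Data.Bool using (Bool; true; false; if_then_else_)
open import Data.List using (List; []; _∷_; foldr; allFin)
open import Data.Maybe using (Maybe; just; nothing)
open import Data.Product using (Σ; ∃; _×_; _,_)
open import Data.Unit using () renaming (⊤ to Unit)
open import Relation.Nullary.Decidable using (does)
open import Relation.Binary.PropositionalEquality using (_≡_)

-- ℤ ∪ {-∞}: nothing = -∞
infixl 6 _+∞_
infixl 7 _*∞_
infix 4 _≤∞_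

ℤ∞ : Set
ℤ∞ = Maybe ℤ

_+∞_ : ℤ∞ → ℤ∞ → ℤ∞
just a +∞ just b = just (a + b)
_ +∞ _ = nothing

-- (value in ℤ ∪ {-∞}) times an integer coefficient, with 0·(-∞) = 0
_*∞_ : ℤ∞ → ℤ → ℤ∞
just a *∞ k = just (a * k)
nothing *∞ (+ zero) = just (+ 0)
nothing *∞ _ = nothing

_≤∞_ : ℤ∞ → ℤ → Set
nothing ≤∞ _ = Unit
just a ≤∞ v = a ≤ v

Supermodular : ∀ {n} → (Subset n → ℤ∞) → Set
Supermodular p = ∀ X Y a b → p X ≡ just a → p Y ≡ just b →
  (just (a + b) ≤∞' (p (X ∩ Y) +∞ p (X ∪ Y)))
  where
  _≤∞'_ : ℤ∞ → ℤ∞ → Set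
  _ ≤∞' nothing = Data.Empty.⊥ where import Data.Empty
  nothing ≤∞' just _ = Unit
  just a ≤∞' just b = a ≤ b

sumFin : ∀ {n} → (Fin n → ℤ) → ℤ
sumFin {zero} f = + 0
sumFin {suc n} f = f zero + sumFin (λ i → f (suc i))

tilde : ∀ {n} → (Fin n → ℤ) → Subset n → ℤ
tilde x Z = sumFin (λ i → if lookup Z i then x i else + 0)

InBdot : ∀ {n} → (Subset n → ℤ∞) → (Fin n → ℤ) → Set
InBdot p x = (p ⊤ ≡ just (tilde x ⊤)) × (∀ Z → p Z ≤∞ tilde x Z)

-- ordering s_1,…,s_n of S with π(s_1) ≥ … ≥ π(s_n) (insertion sort)
insertBy : ∀ {n} → (Fin n → ℤ) → Fin n → List (Fin n) → List (Fin n)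
insertBy π i [] = i ∷ []
insertBy π i (j ∷ js) =
  if does (π i ≤? π j) then j ∷ insertBy π i js else i ∷ j ∷ js

sortDesc : ∀ {n} → (Fin n → ℤ) → List (Fin n)
sortDesc {n} π = foldr (insertBy π) [] (allFin n)

-- given I_{j-1} and the remaining list s_j,…,s_n, compute
--   Σ_{k ≥ j, k < n} p(I_k)[π(s_k) − π(s_{k+1})] + p(I_n) π(s_n)
linAux : ∀ {n} → (Subset n → ℤ∞) → (Fin n → ℤ) → Subset n → List (Fin n) → ℤ∞
linAux p π I [] = just (+ 0)
linAux p π I (s ∷ []) = p (I ∪ ⁅ s ⁆) *∞ π s
linAux p π I (s ∷ t ∷ rest) =
  (p (I ∪ ⁅ s ⁆) *∞ (π s - π t)) +∞ linAux p π (I ∪ ⁅ s ⁆) (t ∷ rest)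

phat : ∀ {n} → (Subset n → ℤ∞) → (Fin n → ℤ) → ℤ∞
phat p π = linAux p π ⊥ (sortDesc π)

-- ⌊ a / d ⌋ for d > 0 (value for d ≤ 0 is irrelevant, set to 0)
floorDiv : ℤ → ℤ → ℤ
floorDiv a (+ suc k) = a /ℕ suc k
floorDiv a _ = + 0

-- ⌊ (π/c + 1)/2 ⌋ = ⌊ (π + c) / (2c) ⌋  (c ≥ 1)
half : ℤ → ℤ → ℤ
half π c = floorDiv (π + c) (+ 2 * c)

primalObj : ∀ {n} → (Fin n → ℤ) → (Fin n → ℤ) → ℤ
primalObj c x = sumFin (λ s → c s * (x s * x s))

dualObj : ∀ {n} → (Subset n → ℤ∞) → (Fin n → ℤ) → (Fin n → ℤ) → ℤ∞
dualObj p c π = phat p π +∞ just (ℤ.- sumFin (λ s → half (π s) (c s) * (π s - c s * half (π s) (c s))))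

-- Weak duality.  For y ∈ Ḃ and integral π, the Lovász extension satisfies
-- p̂(π) ≤ ⟨y, π⟩ (Abel summation along the order of decreasing π, using
-- p ≤ ỹ), and for every s the concave function j ↦ π(s) j − c(s) j² on ℤ is
-- maximised at h = ⌊(π(s)/c(s) + 1)/2⌋.  Summing, dual(π) ≤ Σ c y².
--
-- Strong duality.  Starting at any point of Ḃ, perform exchanges
-- x ↦ x + χ_u − χ_v, with u in the smallest x-tight set dep(v) ∋ v, as long as
-- they lower the objective; the objective is a natural number, so this stops
-- at a local optimum x.  There π(u) = max { 2c(v)x(v) − c(v) : u ∈ dep(v) }
-- lies in [2c(u)x(u) − c(u), 2c(u)x(u) + c(u)], so x(s) maximises each
-- one-dimensional function, and π is monotone along dep, so the upper level
-- sets of π are unions of tight sets, hence tight, giving p̂(π) = ⟨x, π⟩.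
-- Thus dual(π) = Σ c x², and weak duality shows both x and π optimal.

module Submission where

open import Defs
open import Data.Nat using (ℕ; suc)
open import Data.Integer using (ℤ; +_; _≤_)
open import Data.Fin using (Fin)
open import Data.Fin.Subset using (Subset; ⊥; ⊤)
open import Data.Maybe using (just)
open import Data.Product using (Σ; ∃; _×_)
open import Relation.Binary.PropositionalEquality using (_≡_)

open import Function using (_∘_; id)
open import Data.Nat as ℕ using (zero; z≤n)
import Data.Nat.Properties as ℕP
open import Data.Integer
  using (-[1+_]; 0ℤ; 1ℤ; _+_; _-_; _*_; -_; _<_; +≤+; _⊔_; ∣_∣; _/ℕ_; _%ℕ_; nonNegative)
open import Data.Integer.Properties
open import Data.Integer.Properties using () renaming (_≟_ to _≟ℤ_)
open import Data.Integer.DivMod using (a≡a%ℕn+[a/ℕn]*n; n%ℕd<d)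
open import Data.Integer.Tactic.RingSolver using (solve-∀)
open import Data.Fin using (zero; suc) renaming (_≟_ to _≟ᶠ_)
open import Data.Fin.Properties using (any?)
open import Data.Fin.Subset using (_∩_; _∪_; ⁅_⁆)
open import Data.Vec using ([]; _∷_; lookup)
open import Data.Vec.Properties using (lookup-replicate; lookup-zipWith; tabulate∘lookup; tabulate-cong)
open import Data.Bool using (Bool; true; false; if_then_else_; _∧_; _∨_)
open import Data.Bool.Properties using (∨-zeroʳ; ∨-identityʳ)
open import Data.List using (List; []; _∷_; _++_; foldr; tabulate; allFin; map)
open import Data.List.Membership.Propositional using (_∈_)
open import Data.List.Membership.Propositional.Properties using (∈-map⁺; ∈-++⁺ˡ; ∈-++⁺ʳ)
open import Data.List.Relation.Unary.Any using (here; there)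
open import Data.Maybe using (nothing)
import Data.Maybe.Properties as Maybe
open import Data.Product using (_,_; proj₁; proj₂)
open import Data.Sum using (_⊎_; inj₁; inj₂)
open import Data.Unit using (tt) renaming (⊤ to Unit)
open import Relation.Nullary using (Dec; yes; no; does; _×-dec_)
open import Relation.Nullary.Negation using (contradiction)
open import Relation.Binary.PropositionalEquality
  using (_≢_; refl; sym; trans; cong; cong₂; subst; subst₂; module ≡-Reasoning)

*-nonNeg : ∀ {a b} → 0ℤ ≤ a → 0ℤ ≤ b → 0ℤ ≤ a * b
*-nonNeg {a} {b} 0≤a 0≤b =
  subst (_≤ a * b) (*-zeroˡ b) (*-monoʳ-≤-nonNeg b {{nonNegative 0≤b}} 0≤a)

square-nonNeg : ∀ a → 0ℤ ≤ a * a
square-nonNeg (+ k) = *-nonNeg {+ k} {+ k} (+≤+ z≤n) (+≤+ z≤n)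
square-nonNeg -[1+ k ] = subst (0ℤ ≤_) (neg-square (+ suc k)) (square-nonNeg (+ suc k))
  where
  neg-square : ∀ a → a * a ≡ (- a) * (- a)
  neg-square = solve-∀

+-cancelʳ-≤ : ∀ a b c → a + c ≤ b + c → a ≤ b
+-cancelʳ-≤ a b c h = subst₂ _≤_ (cancel a c) (cancel b c) (+-monoˡ-≤ (- c) h)
  where
  cancel : ∀ a c → a + c + - c ≡ a
  cancel = solve-∀

-- If u ≤ T₁, v ≤ T₂ and T₁ + T₂ ≤ u + v then both inequalities are equalities;
-- this is what makes tight sets closed under ∩ and ∪.
squeeze : ∀ {u v T₁ T₂} → u ≤ T₁ → v ≤ T₂ → T₁ + T₂ ≤ u + v → u ≡ T₁ × v ≡ T₂
squeeze {u} {v} {T₁} {T₂} u≤T₁ v≤T₂ T≤uv =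
  ≤-antisym u≤T₁ (+-cancelʳ-≤ T₁ u T₂ (≤-trans T≤uv (+-monoʳ-≤ u v≤T₂))) ,
  ≤-antisym v≤T₂ (+-cancelʳ-≤ T₂ v T₁
    (subst₂ _≤_ (+-comm T₁ T₂) (+-comm T₁ v) (≤-trans T≤uv (+-monoˡ-≤ v u≤T₁))))

sumFin-cong : ∀ {n} {f g : Fin n → ℤ} → (∀ i → f i ≡ g i) → sumFin f ≡ sumFin g
sumFin-cong {zero} h = refl
sumFin-cong {suc n} h = cong₂ _+_ (h zero) (sumFin-cong (h ∘ suc))

sumFin-mono : ∀ {n} {f g : Fin n → ℤ} → (∀ i → f i ≤ g i) → sumFin f ≤ sumFin g
sumFin-mono {zero} h = ≤-refl
sumFin-mono {suc n} h = +-mono-≤ (h zero) (sumFin-mono (h ∘ suc))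

sumFin-+ : ∀ {n} (f g : Fin n → ℤ) → sumFin (λ i → f i + g i) ≡ sumFin f + sumFin g
sumFin-+ {zero} f g = refl
sumFin-+ {suc n} f g =
  trans (cong (_+_ (f zero + g zero)) (sumFin-+ (f ∘ suc) (g ∘ suc)))
        (interchange (f zero) (g zero) (sumFin (f ∘ suc)) (sumFin (g ∘ suc)))
  where
  interchange : ∀ a b c d → (a + b) + (c + d) ≡ (a + c) + (b + d)
  interchange = solve-∀

sumFin-neg : ∀ {n} (f : Fin n → ℤ) → sumFin (λ i → - f i) ≡ - sumFin f
sumFin-neg {zero} f = refl
sumFin-neg {suc n} f =
  trans (cong (_+_ (- f zero)) (sumFin-neg (f ∘ suc))) (sym (neg-distrib-+ (f zero) _))

sumFin-zero : ∀ {n} → sumFin {n} (λ _ → 0ℤ) ≡ 0ℤ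
sumFin-zero {zero} = refl
sumFin-zero {suc n} = trans (+-identityˡ _) (sumFin-zero {n})

sumFin-nonNeg : ∀ {n} (f : Fin n → ℤ) → (∀ i → 0ℤ ≤ f i) → 0ℤ ≤ sumFin f
sumFin-nonNeg {n} f h = subst (_≤ sumFin f) (sumFin-zero {n}) (sumFin-mono h)

point : ∀ {n} → Fin n → ℤ → Fin n → ℤ
point u a i = if does (u ≟ᶠ i) then a else 0ℤ

sumFin-point : ∀ {n} (u : Fin n) a → sumFin (point u a) ≡ a
sumFin-point {suc n} zero a = trans (cong (_+_ a) (sumFin-zero {n})) (+-identityʳ a)
sumFin-point {suc n} (suc u) a = trans (+-identityˡ _) (sumFin-point u a)

lookup-⊥ : ∀ {n} (j : Fin n) → lookup (⊥ {n}) j ≡ false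
lookup-⊥ j = lookup-replicate j false

lookup-⊤ : ∀ {n} (j : Fin n) → lookup (⊤ {n}) j ≡ true
lookup-⊤ j = lookup-replicate j true

lookup-∪ : ∀ {n} (X Y : Subset n) j → lookup (X ∪ Y) j ≡ (lookup X j ∨ lookup Y j)
lookup-∪ X Y j = lookup-zipWith _∨_ j X Y

lookup-∩ : ∀ {n} (X Y : Subset n) j → lookup (X ∩ Y) j ≡ (lookup X j ∧ lookup Y j)
lookup-∩ X Y j = lookup-zipWith _∧_ j X Y

lookup-⁅⁆ : ∀ {n} (s j : Fin n) → lookup ⁅ s ⁆ j ≡ does (s ≟ᶠ j)
lookup-⁅⁆ zero zero = refl
lookup-⁅⁆ zero (suc j) = lookup-⊥ j
lookup-⁅⁆ (suc s) zero = refl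
lookup-⁅⁆ (suc s) (suc j) = lookup-⁅⁆ s j

subset-ext : ∀ {n} {X Y : Subset n} → (∀ j → lookup X j ≡ lookup Y j) → X ≡ Y
subset-ext {X = X} {Y} h =
  trans (sym (tabulate∘lookup X)) (trans (tabulate-cong h) (tabulate∘lookup Y))

false≢true : false ≢ true
false≢true ()

when : Bool → ℤ → ℤ
when b a = if b then a else 0ℤ

restrict : ∀ {n} → (Fin n → ℤ) → Subset n → Fin n → ℤ
restrict x Z i = when (lookup Z i) (x i)

when-zero : ∀ b → when b 0ℤ ≡ 0ℤ
when-zero true = refl
when-zero false = refl

tilde-+ : ∀ {n} (x y : Fin n → ℤ) Z → tilde (λ i → x i + y i) Z ≡ tilde x Z + tilde y Z
tilde-+ x y Z = trans (sumFin-cong (λ i → split (lookup Z i))) (sumFin-+ (restrict x Z) (restrict y Z))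
  where
  split : ∀ b {i} → when b (x i + y i) ≡ when b (x i) + when b (y i)
  split true = refl
  split false = refl

tilde-point : ∀ {n} (u : Fin n) a Z → tilde (point u a) Z ≡ when (lookup Z u) a
tilde-point u a Z = trans (sumFin-cong pointwise) (sumFin-point u _)
  where
  pointwise : ∀ i → when (lookup Z i) (point u a i) ≡ point u (when (lookup Z u) a) i
  pointwise i with u ≟ᶠ i
  ... | yes refl = refl
  ... | no _ = when-zero (lookup Z i)

tilde-modular : ∀ {n} (x : Fin n → ℤ) X Y →
  tilde x X + tilde x Y ≡ tilde x (X ∩ Y) + tilde x (X ∪ Y)
tilde-modular x X Y = begin
  tilde x X + tilde x Y
    ≡⟨ sumFin-+ (restrict x X) (restrict x Y) ⟨
  sumFin (λ i → restrict x X i + restrict x Y i)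
    ≡⟨ sumFin-cong pointwise ⟩
  sumFin (λ i → restrict x (X ∩ Y) i + restrict x (X ∪ Y) i)
    ≡⟨ sumFin-+ (restrict x (X ∩ Y)) (restrict x (X ∪ Y)) ⟩
  tilde x (X ∩ Y) + tilde x (X ∪ Y)
    ∎
  where
  open ≡-Reasoning
  modular : ∀ b c a → when b a + when c a ≡ when (b ∧ c) a + when (b ∨ c) a
  modular true true a = refl
  modular true false a = +-comm a 0ℤ
  modular false c a = refl
  pointwise : ∀ i → when (lookup X i) (x i) + when (lookup Y i) (x i)
                  ≡ when (lookup (X ∩ Y) i) (x i) + when (lookup (X ∪ Y) i) (x i)
  pointwise i rewrite lookup-∩ X Y i | lookup-∪ X Y i = modular (lookup X i) (lookup Y i) (x i)

tilde-⊥ : ∀ {n} (x : Fin n → ℤ) → tilde x ⊥ ≡ 0ℤ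
tilde-⊥ {n} x = trans (sumFin-cong (λ i → cong (λ b → when b (x i)) (lookup-⊥ i))) (sumFin-zero {n})

tilde-⊤ : ∀ {n} (x : Fin n → ℤ) → tilde x ⊤ ≡ sumFin x
tilde-⊤ x = sumFin-cong (λ i → cong (λ b → when b (x i)) (lookup-⊤ i))

tilde-insert : ∀ {n} (x : Fin n → ℤ) I s → lookup I s ≡ false →
  tilde x (I ∪ ⁅ s ⁆) ≡ tilde x I + x s
tilde-insert x I s s∉I =
  trans (sumFin-cong pointwise)
    (trans (sumFin-+ (restrict x I) (point s (x s))) (cong (_+_ (tilde x I)) (sumFin-point s (x s))))
  where
  pointwise : ∀ j → when (lookup (I ∪ ⁅ s ⁆) j) (x j) ≡ when (lookup I j) (x j) + point s (x s) j
  pointwise j rewrite lookup-∪ I ⁅ s ⁆ j | lookup-⁅⁆ s j with s ≟ᶠ j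
  ... | yes refl rewrite s∉I = sym (+-identityˡ (x s))
  ... | no _ rewrite ∨-identityʳ (lookup I j) = sym (+-identityʳ _)

-- Enumerations of complements.  'Complement I l' says that the list l
-- contains every element outside I exactly once and no element of I; this is
-- the invariant maintained by the recursion 'linAux' along the sorted order.

bit : Bool → ℕ
bit b = if b then 1 else 0

count : ∀ {n} → List (Fin n) → Fin n → ℕ
count [] j = 0
count (i ∷ l) j = bit (does (i ≟ᶠ j)) ℕ.+ count l j

record Complement {n} (I : Subset n) (l : List (Fin n)) : Set where
  constructor complement
  field counts : ∀ j → count l j ℕ.+ bit (lookup I j) ≡ 1
open Complement

bit≡0 : ∀ {b} → bit b ≡ 0 → b ≡ false
bit≡0 {false} _ = refl

bit≡1 : ∀ {b} → bit b ≡ 1 → b ≡ true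
bit≡1 {true} _ = refl

complement-head : ∀ {n} {I : Subset n} {s l} → Complement I (s ∷ l) → lookup I s ≡ false
complement-head {I = I} {s} {l} h with s ≟ᶠ s | counts h s
... | yes _ | e = bit≡0 (ℕP.m+n≡0⇒n≡0 (count l s) (ℕP.suc-injective e))
... | no s≢s | _ = contradiction refl s≢s

complement-step : ∀ {n} {I : Subset n} {s l} → Complement I (s ∷ l) → Complement (I ∪ ⁅ s ⁆) l
complement-step {I = I} {s} {l} h = complement counts′
  where
  counts′ : ∀ j → count l j ℕ.+ bit (lookup (I ∪ ⁅ s ⁆) j) ≡ 1
  counts′ j rewrite lookup-∪ I ⁅ s ⁆ j | lookup-⁅⁆ s j with s ≟ᶠ j | counts h j
  ... | yes refl | e rewrite ∨-zeroʳ (lookup I s) =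
    cong (ℕ._+ 1) (ℕP.m+n≡0⇒m≡0 (count l s) (ℕP.suc-injective e))
  ... | no _ | e rewrite ∨-identityʳ (lookup I j) = e

complement-last : ∀ {n} {I : Subset n} {s} → Complement I (s ∷ []) → I ∪ ⁅ s ⁆ ≡ ⊤
complement-last {I = I} {s} h = subset-ext (λ j → trans (covered j) (sym (lookup-⊤ j)))
  where
  covered : ∀ j → lookup (I ∪ ⁅ s ⁆) j ≡ true
  covered j rewrite lookup-∪ I ⁅ s ⁆ j | lookup-⁅⁆ s j with counts h j
  ... | e with s ≟ᶠ j
  ... | yes _ = ∨-zeroʳ (lookup I j)
  ... | no _ rewrite ∨-identityʳ (lookup I j) = bit≡1 e

complement-outside : ∀ {n} {I : Subset n} {l} j → Complement I l → lookup I j ≡ false → count l j ≡ 1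
complement-outside {I = I} {l} j h j∉I =
  trans (sym (ℕP.+-identityʳ _)) (subst (λ b → count l j ℕ.+ bit b ≡ 1) j∉I (counts h j))

count-insert : ∀ {n} (π : Fin n → ℤ) i l j → count (insertBy π i l) j ≡ count (i ∷ l) j
count-insert π i [] j = refl
count-insert π i (k ∷ l) j with does (π i ≤? π k)
... | true = trans (cong (bit (does (k ≟ᶠ j)) ℕ.+_) (count-insert π i l j))
                   (swap (bit (does (k ≟ᶠ j))) (bit (does (i ≟ᶠ j))) (count l j))
  where
  swap : ∀ a b c → a ℕ.+ (b ℕ.+ c) ≡ b ℕ.+ (a ℕ.+ c)
  swap a b c = trans (sym (ℕP.+-assoc a b c)) (trans (cong (ℕ._+ c) (ℕP.+-comm a b)) (ℕP.+-assoc b a c))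
... | false = refl

count-insertAll : ∀ {n} (π : Fin n → ℤ) l j → count (foldr (insertBy π) [] l) j ≡ count l j
count-insertAll π [] j = refl
count-insertAll π (i ∷ l) j =
  trans (count-insert π i (foldr (insertBy π) [] l) j)
        (cong (bit (does (i ≟ᶠ j)) ℕ.+_) (count-insertAll π l j))

count-suc-zero : ∀ {m n} (f : Fin m → Fin n) → count (tabulate (λ i → suc (f i))) zero ≡ 0
count-suc-zero {zero} f = refl
count-suc-zero {suc m} f = count-suc-zero (λ i → f (suc i))

count-suc-suc : ∀ {m n} (f : Fin m → Fin n) j →
  count (tabulate (λ i → suc (f i))) (suc j) ≡ count (tabulate f) j
count-suc-suc {zero} f j = refl
count-suc-suc {suc m} f j = cong (bit (does (f zero ≟ᶠ j)) ℕ.+_) (count-suc-suc (λ i → f (suc i)) j)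

count-allFin : ∀ n (j : Fin n) → count (allFin n) j ≡ 1
count-allFin (suc n) zero = cong suc (count-suc-zero {n} id)
count-allFin (suc n) (suc j) = trans (count-suc-suc {n} id j) (count-allFin n j)

sortDesc-complement : ∀ {n} (π : Fin n → ℤ) → Complement ⊥ (sortDesc π)
sortDesc-complement {n} π = complement counts′
  where
  counts′ : ∀ j → count (sortDesc π) j ℕ.+ bit (lookup ⊥ j) ≡ 1
  counts′ j rewrite lookup-⊥ j =
    trans (ℕP.+-identityʳ _) (trans (count-insertAll π (allFin n) j) (count-allFin n j))

Descending : ∀ {n} → (Fin n → ℤ) → ℤ → List (Fin n) → Set
Descending π b [] = Unit
Descending π b (s ∷ r) = π s ≤ b × Descending π (π s) r

descending-weaken : ∀ {n} (π : Fin n → ℤ) {b b′} l → b ≤ b′ →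
  Descending π b l → Descending π b′ l
descending-weaken π [] b≤b′ d = tt
descending-weaken π (s ∷ r) b≤b′ (s≤b , d) = ≤-trans s≤b b≤b′ , d

descending-insert : ∀ {n} (π : Fin n → ℤ) i b l → π i ≤ b → Descending π b l →
  Descending π b (insertBy π i l)
descending-insert π i b [] i≤b d = i≤b , tt
descending-insert π i b (k ∷ l) i≤b (k≤b , d) with π i ≤? π k
... | yes i≤k = k≤b , descending-insert π i (π k) l i≤k d
... | no i≰k = i≤b , <⇒≤ (≰⇒> i≰k) , d

maxOver : ∀ {n} → (Fin n → ℤ) → List (Fin n) → ℤ
maxOver π [] = 0ℤ
maxOver π (i ∷ l) = π i ⊔ maxOver π l

descending-insertAll : ∀ {n} (π : Fin n → ℤ) l → Descending π (maxOver π l) (foldr (insertBy π) [] l)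
descending-insertAll π [] = tt
descending-insertAll π (i ∷ l) =
  descending-insert π i _ _ (i≤i⊔j (π i) _)
    (descending-weaken π _ (i≤j⊔i (π i) _) (descending-insertAll π l))

descending-bound : ∀ {n} (π : Fin n → ℤ) b l j → Descending π b l → 1 ℕ.≤ count l j → π j ≤ b
descending-bound π b (s ∷ r) j (s≤b , d) occurs with s ≟ᶠ j
... | yes refl = s≤b
... | no _ = ≤-trans (descending-bound π (π s) r j d occurs) s≤b

sortDesc-cons : ∀ {m} (π : Fin (suc m) → ℤ) →
  Σ (Fin (suc m)) λ s → Σ (List (Fin (suc m))) λ r → sortDesc π ≡ s ∷ r × Descending π (π s) r
sortDesc-cons {m} π with sortDesc π | sortDesc-complement π | descending-insertAll π (allFin (suc m))
... | [] | h | _ = contradiction (counts h zero) λ ()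
... | s ∷ r | _ | (_ , d) = s , r , refl , d

*∞-mono : ∀ q v d → q ≤∞ v → 0ℤ ≤ d → q *∞ d ≤∞ v * d
*∞-mono (just a) v (+ k) a≤v _ = *-monoʳ-≤-nonNeg (+ k) a≤v
*∞-mono nothing v (+ zero) _ _ = ≤-reflexive (sym (*-zeroʳ v))
*∞-mono nothing v (+ suc k) _ _ = tt

+∞-mono : ∀ a b u v → a ≤∞ u → b ≤∞ v → a +∞ b ≤∞ u + v
+∞-mono (just a) (just b) u v a≤u b≤v = +-mono-≤ a≤u b≤v
+∞-mono (just a) nothing u v _ _ = tt
+∞-mono nothing b u v _ _ = tt

*∞-zero : ∀ q → q *∞ 0ℤ ≡ just 0ℤ
*∞-zero (just a) = cong just (*-zeroʳ a)
*∞-zero nothing = refl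

Tight : ∀ {n} → (Subset n → ℤ∞) → (Fin n → ℤ) → Subset n → Set
Tight p y Z = p Z ≡ just (tilde y Z)

UpperLevel : ∀ {n} → (Fin n → ℤ) → Subset n → ℤ → Set
UpperLevel π J θ = (∀ i → lookup J i ≡ true → θ < π i) × (∀ i → lookup J i ≡ false → π i ≤ θ)

LevelSetsTight : ∀ {n} → (Subset n → ℤ∞) → (Fin n → ℤ) → (Fin n → ℤ) → Set
LevelSetsTight p y π = ∀ J θ → UpperLevel π J θ → Tight p y J

pairing : ∀ {n} → (Fin n → ℤ) → (Fin n → ℤ) → ℤ
pairing y π = sumFin (λ i → y i * π i)

-- Walking along
-- the sorted order with the prefix set I, Abel summation shows that what
-- 'linAux' still has to add would be 'remainder I s' if every later prefix
-- set were tight; the bounds p ≤ ỹ turn this into an inequality, tightness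
-- of the upper level sets of π into an equality.
module LovaszExtension {n} (p : Subset n → ℤ∞) (π y : Fin n → ℤ) (top : Tight p y ⊤) where

  yπ : Fin n → ℤ
  yπ i = y i * π i

  remainder : Subset n → Fin n → ℤ
  remainder I s = tilde y I * π s + (pairing y π - tilde yπ I)

  -- The last step of linAux: the prefix set becomes S, which is tight.
  remainder-last : ∀ I s → Complement I (s ∷ []) → linAux p π I (s ∷ []) ≡ just (remainder I s)
  remainder-last I s h = trans (cong (_*∞ π s) tight) (cong just last-term)
    where
    s∉I : lookup I s ≡ false
    s∉I = complement-head h
    I∪s≡⊤ : I ∪ ⁅ s ⁆ ≡ ⊤
    I∪s≡⊤ = complement-last h
    tight : Tight p y (I ∪ ⁅ s ⁆)
    tight = subst (Tight p y) (sym I∪s≡⊤) top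
    total : pairing y π ≡ tilde yπ I + yπ s
    total = trans (sym (tilde-⊤ yπ)) (trans (cong (tilde yπ) (sym I∪s≡⊤)) (tilde-insert yπ I s s∉I))
    abel : ∀ A ys πs B → (A + ys) * πs ≡ A * πs + ((B + ys * πs) - B)
    abel = solve-∀
    open ≡-Reasoning
    last-term : tilde y (I ∪ ⁅ s ⁆) * π s ≡ remainder I s
    last-term = begin
      tilde y (I ∪ ⁅ s ⁆) * π s
        ≡⟨ cong (_* π s) (tilde-insert y I s s∉I) ⟩
      (tilde y I + y s) * π s
        ≡⟨ abel (tilde y I) (y s) (π s) (tilde yπ I) ⟩
      tilde y I * π s + ((tilde yπ I + yπ s) - tilde yπ I)
        ≡⟨ cong (λ t → tilde y I * π s + (t - tilde yπ I)) total ⟨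
      remainder I s
        ∎

  -- One step of Abel summation, assuming the new prefix set I ∪ {s} is tight.
  remainder-step : ∀ I s t → lookup I s ≡ false →
    tilde y (I ∪ ⁅ s ⁆) * (π s - π t) + remainder (I ∪ ⁅ s ⁆) t ≡ remainder I s
  remainder-step I s t s∉I rewrite tilde-insert y I s s∉I | tilde-insert yπ I s s∉I =
    abel (tilde y I) (y s) (π s) (π t) (tilde yπ I) (pairing y π)
    where
    abel : ∀ A ys πs πt B T → (A + ys) * (πs - πt) + ((A + ys) * πt + (T - (B + ys * πs)))
                              ≡ A * πs + (T - B)
    abel = solve-∀

  -- With p ≤ ỹ each step term is at most its tight value.
  linAux-≤ : (∀ Z → p Z ≤∞ tilde y Z) → ∀ I s r → Complement I (s ∷ r) → Descending π (π s) r →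
    linAux p π I (s ∷ r) ≤∞ remainder I s
  linAux-≤ p≤ỹ I s [] h _ rewrite remainder-last I s h = ≤-refl
  linAux-≤ p≤ỹ I s (t ∷ r) h (t≤s , d) =
    subst (linAux p π I (s ∷ t ∷ r) ≤∞_) (remainder-step I s t (complement-head h))
      (+∞-mono _ _ _ _ (*∞-mono (p (I ∪ ⁅ s ⁆)) _ _ (p≤ỹ _) (i≤j⇒0≤j-i t≤s))
        (linAux-≤ p≤ỹ (I ∪ ⁅ s ⁆) t r (complement-step h) d))

  -- The step term p(I ∪ {s})·(π s − π t) is exact: either π s = π t, or
  -- I ∪ {s} is the upper level set of π at θ = π t.
  step-exact : LevelSetsTight p y π → ∀ I s t r → Complement I (s ∷ t ∷ r) → Descending π (π t) r →
    (∀ i → lookup I i ≡ true → π s ≤ π i) → π t ≤ π s →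
    p (I ∪ ⁅ s ⁆) *∞ (π s - π t) ≡ just (tilde y (I ∪ ⁅ s ⁆) * (π s - π t))
  step-exact levels I s t r h d above t≤s with π s ≤? π t
  ... | yes s≤t rewrite ≤-antisym s≤t t≤s | +-inverseʳ (π t) =
    trans (*∞-zero (p (I ∪ ⁅ s ⁆))) (cong just (sym (*-zeroʳ (tilde y (I ∪ ⁅ s ⁆)))))
  ... | no s≰t = cong (_*∞ (π s - π t)) (levels (I ∪ ⁅ s ⁆) (π t) (inside , outside))
    where
    inside : ∀ i → lookup (I ∪ ⁅ s ⁆) i ≡ true → π t < π i
    inside i i∈J rewrite lookup-∪ I ⁅ s ⁆ i | lookup-⁅⁆ s i with lookup I i in i∈I | s ≟ᶠ i
    ... | true | _ = <-≤-trans (≰⇒> s≰t) (above i i∈I)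
    ... | false | yes refl = ≰⇒> s≰t
    outside : ∀ i → lookup (I ∪ ⁅ s ⁆) i ≡ false → π i ≤ π t
    outside i i∉J = descending-bound π (π t) (t ∷ r) i (≤-refl , d)
      (ℕP.≤-reflexive (sym (complement-outside i (complement-step h) i∉J)))

  -- With tight upper level sets every step is exact; the invariant 'above'
  -- says that the prefix set I consists of elements with π at least π s.
  linAux-≡ : LevelSetsTight p y π → ∀ I s r → Complement I (s ∷ r) → Descending π (π s) r →
    (∀ i → lookup I i ≡ true → π s ≤ π i) → linAux p π I (s ∷ r) ≡ just (remainder I s)
  linAux-≡ levels I s [] h _ _ = remainder-last I s h
  linAux-≡ levels I s (t ∷ r) h (t≤s , d) above =
    trans (cong₂ _+∞_ (step-exact levels I s t r h d above t≤s)
                      (linAux-≡ levels (I ∪ ⁅ s ⁆) t r (complement-step h) d above′))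
          (cong just (remainder-step I s t (complement-head h)))
    where
    above′ : ∀ i → lookup (I ∪ ⁅ s ⁆) i ≡ true → π t ≤ π i
    above′ i i∈J rewrite lookup-∪ I ⁅ s ⁆ i | lookup-⁅⁆ s i with lookup I i in i∈I | s ≟ᶠ i
    ... | true | _ = ≤-trans t≤s (above i i∈I)
    ... | false | yes refl = t≤s

remainder-⊥ : ∀ {n} (p : Subset n → ℤ∞) (π y : Fin n → ℤ) top s →
  LovaszExtension.remainder p π y top ⊥ s ≡ pairing y π
remainder-⊥ p π y top s rewrite tilde-⊥ y | tilde-⊥ (λ i → y i * π i) =
  trans (+-identityˡ _) (+-identityʳ _)

lovasz-≤ : ∀ {m} (p : Subset (suc m) → ℤ∞) (π y : Fin (suc m) → ℤ) → InBdot p y →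
  phat p π ≤∞ pairing y π
lovasz-≤ p π y (top , p≤ỹ) with sortDesc-cons π
... | s , r , sorted , d =
  subst₂ _≤∞_ (cong (linAux p π ⊥) (sym sorted)) (remainder-⊥ p π y top s)
    (linAux-≤ p≤ỹ ⊥ s r (subst (Complement ⊥) sorted (sortDesc-complement π)) d)
  where open LovaszExtension p π y top

lovasz-≡ : ∀ {m} (p : Subset (suc m) → ℤ∞) (π y : Fin (suc m) → ℤ) → Tight p y ⊤ →
  LevelSetsTight p y π → phat p π ≡ just (pairing y π)
lovasz-≡ p π y top levels with sortDesc-cons π
... | s , r , sorted , d =
  trans (cong (linAux p π ⊥) sorted)
    (trans (linAux-≡ levels ⊥ s r (subst (Complement ⊥) sorted (sortDesc-complement π)) d nothing-below)
           (cong just (remainder-⊥ p π y top s)))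
  where
  open LovaszExtension p π y top
  nothing-below : ∀ i → lookup ⊥ i ≡ true → π s ≤ π i
  nothing-below i i∈⊥ = contradiction (trans (sym (lookup-⊥ i)) i∈⊥) false≢true

-- For c ≥ 1 the concave function
-- gain π c j = π j − c j² on ℤ is maximised at j = ⌊(π + c)/(2c)⌋ = half π c,
-- and also at every j = x with lower c x ≤ π ≤ upper c x.  The dual objective
-- of Defs subtracts exactly the maxima h(π − c h) of these functions.

gain : ℤ → ℤ → ℤ → ℤ
gain π c j = π * j - c * (j * j)

lower upper : ℤ → ℤ → ℤ
lower c x = x * (+ 2 * c) - c
upper c x = x * (+ 2 * c) + c

-- For 0 ≤ r ≤ 2c the quadratic d(cd + r − c) is nonnegative at every integer d:
-- its roots 0 and 1 − r/c both lie in [−1, 1].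
quadratic-nonNeg : ∀ c r d → 0ℤ ≤ c → 0ℤ ≤ r → r ≤ + 2 * c → 0ℤ ≤ d * (c * d + r - c)
quadratic-nonNeg c r (+ zero) _ _ _ = ≤-reflexive (sym (*-zeroˡ (c * + zero + r - c)))
quadratic-nonNeg c r (+ suc e) 0≤c 0≤r _ =
  *-nonNeg {+ suc e} (+≤+ z≤n)
    (subst (0ℤ ≤_) (sym (shift c r (+ e))) (+-mono-≤ (*-nonNeg 0≤c (+≤+ z≤n)) 0≤r))
  where
  shift : ∀ c r e → c * (+ 1 + e) + r - c ≡ c * e + r
  shift = solve-∀
quadratic-nonNeg c r -[1+ e ] 0≤c _ r≤2c =
  subst (0ℤ ≤_) (sym (reflect c r (+ suc e)))
    (*-nonNeg {+ suc e} (+≤+ z≤n)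
      (+-mono-≤ (*-nonNeg 0≤c (i≤j⇒0≤j-i (+≤+ (ℕ.s≤s z≤n)))) (i≤j⇒0≤j-i r≤2c)))
  where
  reflect : ∀ c r f → (- f) * (c * (- f) + r - c) ≡ f * (c * (f - + 1) + (+ 2 * c - r))
  reflect = solve-∀

gain-max : ∀ π c h r → 0ℤ ≤ c → 0ℤ ≤ r → r ≤ + 2 * c → π ≡ r + h * (+ 2 * c) - c →
  ∀ j → gain π c j ≤ h * (π - c * h)
gain-max π c h r 0≤c 0≤r r≤2c refl j =
  0≤i-j⇒j≤i (subst (0ℤ ≤_) (sym (difference c h j r)) (quadratic-nonNeg c r (h - j) 0≤c 0≤r r≤2c))
  where
  difference : ∀ c h j r →
    h * ((r + h * (+ 2 * c) - c) - c * h) - ((r + h * (+ 2 * c) - c) * j - c * (j * j))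
    ≡ (h - j) * (c * (h - j) + r - c)
  difference = solve-∀

-- Division with remainder puts π in the form required by 'gain-max' with h = half π c.
half-maximises : ∀ π c → + 1 ≤ c → ∀ j → gain π c j ≤ half π c * (π - c * half π c)
half-maximises π (+ zero) (+≤+ ())
half-maximises π (+ suc k) _ =
  gain-max π (+ suc k) q (+ r) (+≤+ z≤n) (+≤+ z≤n) (+≤+ (ℕP.<⇒≤ (n%ℕd<d (π + + suc k) d))) π≡
  where
  d : ℕ
  d = 2 ℕ.* suc k
  q : ℤ
  q = (π + + suc k) /ℕ d
  r : ℕ
  r = (π + + suc k) %ℕ d
  unshift : ∀ π c a → π + c ≡ a → π ≡ a - c
  unshift π c a refl = sym (cancel π c)
    where
    cancel : ∀ π c → π + c - c ≡ π
    cancel = solve-∀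
  π≡ : π ≡ + r + q * (+ 2 * + suc k) - + suc k
  π≡ = unshift π (+ suc k) _ (a≡a%ℕn+[a/ℕn]*n (π + + suc k) d)

interval-maximises : ∀ π c x → 0ℤ ≤ c → lower c x ≤ π → π ≤ upper c x →
  ∀ j → gain π c j ≤ x * (π - c * x)
interval-maximises π c x 0≤c lo≤π π≤up =
  gain-max π c x (π - lower c x) 0≤c (i≤j⇒0≤j-i lo≤π) r≤2c (sym (recombine π c x))
  where
  recombine : ∀ π c x → (π - (x * (+ 2 * c) - c)) + x * (+ 2 * c) - c ≡ π
  recombine = solve-∀
  width : ∀ π c x → + 2 * c - ((x * (+ 2 * c) + c) - π) ≡ π - (x * (+ 2 * c) - c)
  width = solve-∀
  r≤2c : π - lower c x ≤ + 2 * c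
  r≤2c = subst (_≤ + 2 * c) (width π c x)
           (i-j≤i (+ 2 * c) (upper c x - π) {{nonNegative (i≤j⇒0≤j-i π≤up)}})

half-value : ∀ π c x → + 1 ≤ c → lower c x ≤ π → π ≤ upper c x →
  half π c * (π - c * half π c) ≡ gain π c x
half-value π c x 1≤c lo≤π π≤up = ≤-antisym
  (≤-trans (≤-reflexive (sym (factor π c (half π c))))
    (≤-trans (interval-maximises π c x (≤-trans (+≤+ z≤n) 1≤c) lo≤π π≤up (half π c))
             (≤-reflexive (sym (factor π c x)))))
  (half-maximises π c 1≤c x)
  where
  factor : ∀ π c x → π * x - c * (x * x) ≡ x * (π - c * x)
  factor = solve-∀

-- For x ∈ Ḃ the x-tight sets (x̃(Z) = p(Z)) form a lattice
-- closed under ∩ and ∪, by supermodularity of p and modularity of x̃.  The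
-- smallest tight set dep(v) containing v governs the elementary exchanges:
-- x + χ_u − χ_v stays in Ḃ whenever u ∈ dep(v).  A set closed under
-- v ↦ dep(v) is a union of tight sets, hence tight.

-- An explicit list of all subsets of Fin n, over which tight sets are intersected.
allSubsets : ∀ n → List (Subset n)
allSubsets zero = [] ∷ []
allSubsets (suc n) = map (true ∷_) (allSubsets n) ++ map (false ∷_) (allSubsets n)

allSubsets-complete : ∀ {n} (Z : Subset n) → Z ∈ allSubsets n
allSubsets-complete [] = here refl
allSubsets-complete {suc n} (true ∷ Z) = ∈-++⁺ˡ (∈-map⁺ (true ∷_) (allSubsets-complete Z))
allSubsets-complete {suc n} (false ∷ Z) =
  ∈-++⁺ʳ (map (true ∷_) (allSubsets n)) (∈-map⁺ (false ∷_) (allSubsets-complete Z))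

exchange : ∀ {n} → (Fin n → ℤ) → Fin n → Fin n → Fin n → ℤ
exchange x u v i = x i + point u 1ℤ i + point v (- 1ℤ) i

tilde-exchange : ∀ {n} (x : Fin n → ℤ) u v Z →
  tilde (exchange x u v) Z ≡ tilde x Z + when (lookup Z u) 1ℤ + when (lookup Z v) (- 1ℤ)
tilde-exchange x u v Z =
  trans (tilde-+ (λ i → x i + point u 1ℤ i) (point v (- 1ℤ)) Z)
    (cong₂ _+_ (trans (tilde-+ x (point u 1ℤ) Z) (cong (_+_ (tilde x Z)) (tilde-point u 1ℤ Z)))
               (tilde-point v (- 1ℤ) Z))

∧-true : ∀ {a b} → (a ∧ b) ≡ true → a ≡ true × b ≡ true
∧-true {true} {true} _ = refl , refl

∨-true : ∀ {a b} → (a ∨ b) ≡ true → a ≡ true ⊎ b ≡ true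
∨-true {true} _ = inj₁ refl
∨-true {false} e = inj₂ e

module TightSets {n} (p : Subset n → ℤ∞) (super : Supermodular p) (p⊥ : p ⊥ ≡ just 0ℤ)
                 (x : Fin n → ℤ) (x∈B : InBdot p x) where

  tight? : ∀ Z → Dec (Tight p x Z)
  tight? Z = Maybe.≡-dec _≟ℤ_ (p Z) (just (tilde x Z))

  ⊥-tight : Tight p x ⊥
  ⊥-tight = trans p⊥ (cong just (sym (tilde-⊥ x)))

  ∩∪-tight : ∀ X Y → Tight p x X → Tight p x Y → Tight p x (X ∩ Y) × Tight p x (X ∪ Y)
  ∩∪-tight X Y tX tY with p (X ∩ Y) in p∩ | p (X ∪ Y) in p∪ | super X Y (tilde x X) (tilde x Y) tX tY
  ... | just a | just b | a+b≤ = cong just (proj₁ equal) , cong just (proj₂ equal)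
    where
    equal : a ≡ tilde x (X ∩ Y) × b ≡ tilde x (X ∪ Y)
    equal = squeeze (subst (_≤∞ tilde x (X ∩ Y)) p∩ (proj₂ x∈B (X ∩ Y)))
                    (subst (_≤∞ tilde x (X ∪ Y)) p∪ (proj₂ x∈B (X ∪ Y)))
                    (subst (_≤ a + b) (tilde-modular x X Y) a+b≤)

  meetTight : Fin n → List (Subset n) → Subset n
  meetTight v [] = ⊤
  meetTight v (Z ∷ Zs) with does (tight? Z) ∧ lookup Z v
  ... | true = Z ∩ meetTight v Zs
  ... | false = meetTight v Zs

  meetTight-tight : ∀ v Zs → Tight p x (meetTight v Zs)
  meetTight-tight v [] = proj₁ x∈B
  meetTight-tight v (Z ∷ Zs) with tight? Z | lookup Z v
  ... | yes tZ | true = proj₁ (∩∪-tight Z _ tZ (meetTight-tight v Zs))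
  ... | yes _ | false = meetTight-tight v Zs
  ... | no _ | _ = meetTight-tight v Zs

  meetTight-∋ : ∀ v Zs → lookup (meetTight v Zs) v ≡ true
  meetTight-∋ v [] = lookup-⊤ v
  meetTight-∋ v (Z ∷ Zs) with tight? Z | lookup Z v in v∈Z
  ... | yes _ | true = trans (lookup-∩ Z _ v) (cong₂ _∧_ v∈Z (meetTight-∋ v Zs))
  ... | yes _ | false = meetTight-∋ v Zs
  ... | no _ | _ = meetTight-∋ v Zs

  meetTight-least : ∀ v Zs Z → Z ∈ Zs → Tight p x Z → lookup Z v ≡ true →
    ∀ i → lookup (meetTight v Zs) i ≡ true → lookup Z i ≡ true
  meetTight-least v (Z′ ∷ Zs) Z Z∈ tZ v∈Z i i∈meet with tight? Z′ | lookup Z′ v in v∈Z′ | Z∈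
  ... | yes _ | true | here refl = proj₁ (∧-true (trans (sym (lookup-∩ Z′ _ i)) i∈meet))
  ... | yes _ | true | there Z∈Zs =
    meetTight-least v Zs Z Z∈Zs tZ v∈Z i (proj₂ (∧-true (trans (sym (lookup-∩ Z′ _ i)) i∈meet)))
  ... | yes _ | false | here refl = contradiction (trans (sym v∈Z′) v∈Z) false≢true
  ... | yes _ | false | there Z∈Zs = meetTight-least v Zs Z Z∈Zs tZ v∈Z i i∈meet
  ... | no ¬tZ | _ | here refl = contradiction tZ ¬tZ
  ... | no _ | _ | there Z∈Zs = meetTight-least v Zs Z Z∈Zs tZ v∈Z i i∈meet

  -- dep v: the smallest tight set containing v; 'Dep v u' reads u ∈ dep v.
  dep : Fin n → Subset n
  dep v = meetTight v (allSubsets n)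

  Dep : Fin n → Fin n → Set
  Dep v u = lookup (dep v) u ≡ true

  Dep? : ∀ v u → Dec (Dep v u)
  Dep? v u = lookup (dep v) u Data.Bool.Properties.≟ true
    where import Data.Bool.Properties

  dep-tight : ∀ v → Tight p x (dep v)
  dep-tight v = meetTight-tight v (allSubsets n)

  Dep-refl : ∀ v → Dep v v
  Dep-refl v = meetTight-∋ v (allSubsets n)

  dep-least : ∀ v Z → Tight p x Z → lookup Z v ≡ true → ∀ u → Dep v u → lookup Z u ≡ true
  dep-least v Z tZ v∈Z = meetTight-least v (allSubsets n) Z (allSubsets-complete Z) tZ v∈Z

  -- u ∈ dep v and w ∈ dep u give w ∈ dep v, since dep v is a tight set containing u.
  Dep-trans : ∀ v u w → Dep v u → Dep u w → Dep v w
  Dep-trans v u w vu uw = dep-least u (dep v) (dep-tight v) vu w uw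

  depUnion : Subset n → List (Fin n) → Subset n
  depUnion J [] = ⊥
  depUnion J (v ∷ vs) with lookup J v
  ... | true = dep v ∪ depUnion J vs
  ... | false = depUnion J vs

  depUnion-tight : ∀ J vs → Tight p x (depUnion J vs)
  depUnion-tight J [] = ⊥-tight
  depUnion-tight J (v ∷ vs) with lookup J v
  ... | true = proj₂ (∩∪-tight (dep v) _ (dep-tight v) (depUnion-tight J vs))
  ... | false = depUnion-tight J vs

  depUnion-source : ∀ J vs i → lookup (depUnion J vs) i ≡ true →
    Σ (Fin n) λ v → lookup J v ≡ true × Dep v i
  depUnion-source J [] i i∈ = contradiction (trans (sym (lookup-⊥ i)) i∈) false≢true
  depUnion-source J (v ∷ vs) i i∈ with lookup J v in v∈J
  ... | false = depUnion-source J vs i i∈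
  ... | true with ∨-true {lookup (dep v) i} (trans (sym (lookup-∪ (dep v) _ i)) i∈)
  ...   | inj₁ vi = v , v∈J , vi
  ...   | inj₂ i∈′ = depUnion-source J vs i i∈′

  depUnion-cover : ∀ J vs i → lookup J i ≡ true → 1 ℕ.≤ count vs i → lookup (depUnion J vs) i ≡ true
  depUnion-cover J (v ∷ vs) i i∈J occurs with v ≟ᶠ i
  ... | yes refl rewrite i∈J = trans (lookup-∪ (dep i) _ i) (cong (_∨ lookup (depUnion J vs) i) (Dep-refl i))
  ... | no _ with lookup J v
  ...   | true = trans (lookup-∪ (dep v) _ i)
                   (trans (cong (lookup (dep v) i ∨_) (depUnion-cover J vs i i∈J occurs)) (∨-zeroʳ _))
  ...   | false = depUnion-cover J vs i i∈J occurs

  Closed : Subset n → Set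
  Closed J = ∀ v u → lookup J v ≡ true → Dep v u → lookup J u ≡ true

  closed-tight : ∀ J → Closed J → Tight p x J
  closed-tight J closed = subst (Tight p x) (subset-ext same) (depUnion-tight J (allFin n))
    where
    same : ∀ i → lookup (depUnion J (allFin n)) i ≡ lookup J i
    same i with lookup J i in i∈J
    ... | true = depUnion-cover J (allFin n) i i∈J (ℕP.≤-reflexive (sym (count-allFin n i)))
    ... | false with lookup (depUnion J (allFin n)) i in i∈U
    ...   | false = refl
    ...   | true with depUnion-source J (allFin n) i i∈U
    ...     | v , v∈J , vi = trans (sym (closed v i v∈J vi)) i∈J

  -- A set containing v but not u ∈ dep v is not tight, so p stays strictly below x̃ on it.
  strictly-below : ∀ v u Z a → Dep v u → p Z ≡ just a → lookup Z v ≡ true → lookup Z u ≡ false →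
    a < tilde x Z
  strictly-below v u Z a vu pZ v∈Z u∉Z = ≤∧≢⇒< (subst (_≤∞ tilde x Z) pZ (proj₂ x∈B Z)) not-tight
    where
    not-tight : a ≢ tilde x Z
    not-tight a≡ =
      contradiction (trans (sym u∉Z) (dep-least v Z (trans pZ (cong just a≡)) v∈Z u vu)) false≢true

  -- The exchange x + χ_u − χ_v with u ∈ dep v stays in Ḃ: only sets containing
  -- v but not u lose one unit, and on those p is strictly below x̃.
  exchange-∈B : ∀ u v → Dep v u → InBdot p (exchange x u v)
  exchange-∈B u v vu = top , bounded
    where
    cancel : ∀ a → a + 1ℤ + - 1ℤ ≡ a
    cancel = solve-∀
    top : p ⊤ ≡ just (tilde (exchange x u v) ⊤)
    top rewrite tilde-exchange x u v ⊤ | lookup-⊤ u | lookup-⊤ v | cancel (tilde x ⊤) = proj₁ x∈B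
    bounded : ∀ Z → p Z ≤∞ tilde (exchange x u v) Z
    bounded Z rewrite tilde-exchange x u v Z with p Z in pZ | proj₂ x∈B Z
    ... | nothing | _ = tt
    ... | just a | a≤ with lookup Z u in u∈Z | lookup Z v in v∈Z
    ...   | true | true rewrite cancel (tilde x Z) = a≤
    ...   | true | false = ≤-trans a≤ (≤-trans (i≤i+j (tilde x Z) 1ℤ) (≤-reflexive (sym (+-identityʳ _))))
    ...   | false | false = ≤-trans a≤ (≤-reflexive (sym (trans (+-identityʳ _) (+-identityʳ _))))
    ...   | false | true = subst (a ≤_) (sym (predecessor (tilde x Z)))
                             (i<j⇒i≤pred[j] (strictly-below v u Z a vu pZ v∈Z u∈Z))
      where
      predecessor : ∀ t → t + 0ℤ + - 1ℤ ≡ - 1ℤ + t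
      predecessor = solve-∀

objective-nonNeg : ∀ {n} (c : Fin n → ℤ) → (∀ s → + 1 ≤ c s) → ∀ y → 0ℤ ≤ primalObj c y
objective-nonNeg c c≥1 y =
  sumFin-nonNeg _ (λ s → *-nonNeg (≤-trans (+≤+ z≤n) (c≥1 s)) (square-nonNeg (y s)))

objective-exchange : ∀ {n} (c x : Fin n → ℤ) u v → u ≢ v →
  primalObj c (exchange x u v) ≡ primalObj c x + upper (c u) (x u) + - lower (c v) (x v)
objective-exchange c x u v u≢v = begin
  primalObj c (exchange x u v)
    ≡⟨ sumFin-cong pointwise ⟩
  sumFin (λ i → c i * (x i * x i) + point u U i + point v (- L) i)
    ≡⟨ sumFin-+ (λ i → c i * (x i * x i) + point u U i) (point v (- L)) ⟩
  sumFin (λ i → c i * (x i * x i) + point u U i) + sumFin (point v (- L))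
    ≡⟨ cong₂ _+_ (sumFin-+ (λ i → c i * (x i * x i)) (point u U)) (sumFin-point v (- L)) ⟩
  primalObj c x + sumFin (point u U) + - L
    ≡⟨ cong (λ t → primalObj c x + t + - L) (sumFin-point u U) ⟩
  primalObj c x + U + - L
    ∎
  where
  open ≡-Reasoning
  U L : ℤ
  U = upper (c u) (x u)
  L = lower (c v) (x v)
  pointwise : ∀ i → c i * (exchange x u v i * exchange x u v i)
    ≡ c i * (x i * x i) + point u U i + point v (- L) i
  pointwise i with u ≟ᶠ i | v ≟ᶠ i
  ... | yes refl | yes refl = contradiction refl u≢v
  ... | yes refl | no _ = increment (c i) (x i)
    where
    increment : ∀ c x → c * ((x + 1ℤ + 0ℤ) * (x + 1ℤ + 0ℤ)) ≡ c * (x * x) + (x * (+ 2 * c) + c) + 0ℤ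
    increment = solve-∀
  ... | no _ | yes refl = decrement (c i) (x i)
    where
    decrement : ∀ c x →
      c * ((x + 0ℤ + - 1ℤ) * (x + 0ℤ + - 1ℤ)) ≡ c * (x * x) + 0ℤ + - (x * (+ 2 * c) - c)
    decrement = solve-∀
  ... | no _ | no _ = unchanged (c i) (x i)
    where
    unchanged : ∀ c x → c * ((x + 0ℤ + 0ℤ) * (x + 0ℤ + 0ℤ)) ≡ c * (x * x) + 0ℤ + 0ℤ
    unchanged = solve-∀

maxFin : ∀ {m} → (Fin (suc m) → ℤ) → ℤ
maxFin {zero} f = f zero
maxFin {suc m} f = f zero ⊔ maxFin (f ∘ suc)

maxFin-upper : ∀ {m} (f : Fin (suc m) → ℤ) i → f i ≤ maxFin f
maxFin-upper {zero} f zero = ≤-refl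
maxFin-upper {suc m} f zero = i≤i⊔j (f zero) _
maxFin-upper {suc m} f (suc i) = ≤-trans (maxFin-upper (f ∘ suc) i) (i≤j⊔i (f zero) _)

maxFin-least : ∀ {m} (f : Fin (suc m) → ℤ) b → (∀ i → f i ≤ b) → maxFin f ≤ b
maxFin-least {zero} f b bound = bound zero
maxFin-least {suc m} f b bound = ⊔-lub (bound zero) (maxFin-least (f ∘ suc) b (bound ∘ suc))

module MinMax {m} (p : Subset (suc m) → ℤ∞) (super : Supermodular p) (p⊥ : p ⊥ ≡ just 0ℤ)
              (c : Fin (suc m) → ℤ) (c≥1 : ∀ s → + 1 ≤ c s) where

  n : ℕ
  n = suc m

  obj : (Fin n → ℤ) → ℤ
  obj = primalObj c

  module Tightness (x : Fin n → ℤ) (x∈B : InBdot p x) = TightSets p super p⊥ x x∈B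

  -- x is locally optimal when no exchange x + χ_u − χ_v with u ∈ dep v lowers obj.
  record LocalOptimum : Set where
    field
      solution : Fin n → ℤ
      inB      : InBdot p solution
      optimal  : ∀ v u → Tightness.Dep solution inB v u →
                 lower (c v) (solution v) ≤ upper (c u) (solution u)

  lower≤upper : ∀ (x : Fin n → ℤ) u → lower (c u) (x u) ≤ upper (c u) (x u)
  lower≤upper x u = 0≤i-j⇒j≤i (subst (0ℤ ≤_) (sym (width (c u) (x u))) (+-mono-≤ c≥0 c≥0))
    where
    c≥0 : 0ℤ ≤ c u
    c≥0 = ≤-trans (+≤+ z≤n) (c≥1 u)
    width : ∀ c x → (x * (+ 2 * c) + c) - (x * (+ 2 * c) - c) ≡ c + c
    width = solve-∀

  exchange-improves : ∀ (x : Fin n → ℤ) u v → u ≢ v → upper (c u) (x u) < lower (c v) (x v) →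
    obj (exchange x u v) < obj x
  exchange-improves x u v u≢v U<L = begin-strict
    obj (exchange x u v)  ≡⟨ trans (objective-exchange c x u v u≢v) (regroup (obj x) U L) ⟩
    obj x + (U - L)       <⟨ +-monoʳ-< (obj x) U-L<0 ⟩
    obj x + 0ℤ            ≡⟨ +-identityʳ (obj x) ⟩
    obj x                 ∎
    where
    open ≤-Reasoning
    U L : ℤ
    U = upper (c u) (x u)
    L = lower (c v) (x v)
    regroup : ∀ o a b → o + a + - b ≡ o + (a - b)
    regroup = solve-∀
    U-L<0 : U - L < 0ℤ
    U-L<0 = subst (U - L <_) (+-inverseʳ L) (+-monoˡ-< (- L) U<L)

  violation-distinct : ∀ (x : Fin n → ℤ) u v → upper (c u) (x u) < lower (c v) (x v) → u ≢ v
  violation-distinct x u v up<lo refl = ≤⇒≯ (lower≤upper x u) up<lo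

  -- Descent: repeat improving exchanges; the objective is a natural number
  -- bounded by k, so after at most k steps a local optimum is reached.
  descent : ∀ k x (x∈B : InBdot p x) → obj x ≤ + k → LocalOptimum
  descent k x x∈B obj≤k with any? (λ v → any? (λ u →
    Tightness.Dep? x x∈B v u ×-dec (upper (c u) (x u) <? lower (c v) (x v))))
  ... | no none = record
    { solution = x ; inB = x∈B ; optimal = λ v u vu → ≮⇒≥ (λ up<lo → none (v , u , vu , up<lo)) }
  ... | yes (v , u , vu , up<lo)
    with k | <-≤-trans (exchange-improves x u v (violation-distinct x u v up<lo) up<lo) obj≤k
  ...   | zero | below0 = contradiction (objective-nonNeg c c≥1 (exchange x u v)) (<⇒≱ below0)
  ...   | suc k′ | below =
    descent k′ (exchange x u v) (Tightness.exchange-∈B x x∈B u v vu) (i<j⇒i≤pred[j] below)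

  localOptimum : ∀ x₀ → InBdot p x₀ → LocalOptimum
  localOptimum x₀ x₀∈B =
    descent ∣ obj x₀ ∣ x₀ x₀∈B (≤-reflexive (sym (0≤i⇒+∣i∣≡i (objective-nonNeg c c≥1 x₀))))

  -- Local optimality keeps π
  -- inside the intervals [lower, upper], and π is monotone along dep, so
  -- its upper level sets are closed and therefore tight.
  module Certificate (opt : LocalOptimum) where
    open LocalOptimum opt renaming (solution to x)
    open Tightness x inB

    candidate : Fin n → Fin n → ℤ
    candidate v u = if does (Dep? v u) then lower (c v) (x v) else lower (c u) (x u)

    π : Fin n → ℤ
    π u = maxFin (λ v → candidate v u)

    candidate-dep : ∀ v u → Dep v u → candidate v u ≡ lower (c v) (x v)
    candidate-dep v u vu with Dep? v u
    ... | yes _ = refl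
    ... | no ¬vu = contradiction vu ¬vu

    lower-≤-π : ∀ v u → Dep v u → lower (c v) (x v) ≤ π u
    lower-≤-π v u vu = subst (_≤ π u) (candidate-dep v u vu) (maxFin-upper (λ w → candidate w u) v)

    π-lower : ∀ u → lower (c u) (x u) ≤ π u
    π-lower u = lower-≤-π u u (Dep-refl u)

    π-upper : ∀ u → π u ≤ upper (c u) (x u)
    π-upper u = maxFin-least _ _ bounded
      where
      bounded : ∀ v → candidate v u ≤ upper (c u) (x u)
      bounded v with Dep? v u
      ... | yes vu = optimal v u vu
      ... | no _ = lower≤upper x u

    π-monotone : ∀ v u → Dep v u → π v ≤ π u
    π-monotone v u vu = maxFin-least _ _ bounded
      where
      bounded : ∀ w → candidate w v ≤ π u
      bounded w with Dep? w v
      ... | yes wv = lower-≤-π w u (Dep-trans w v u wv vu)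
      ... | no _ = lower-≤-π v u vu

    levels-tight : LevelSetsTight p x π
    levels-tight J θ (above , below) = closed-tight J closed
      where
      closed : Closed J
      closed v u v∈J vu with lookup J u in u∈J
      ... | true = refl
      ... | false = contradiction (<-≤-trans (above v v∈J) (π-monotone v u vu)) (≤⇒≯ (below u u∈J))

  conjugateSum : (Fin n → ℤ) → ℤ
  conjugateSum π = sumFin (λ s → half (π s) (c s) * (π s - c s * half (π s) (c s)))

  gain-sum : ∀ (π y : Fin n → ℤ) → sumFin (λ s → gain (π s) (c s) (y s)) ≡ pairing y π + - obj y
  gain-sum π y =
    trans (sumFin-+ (λ s → π s * y s) (λ s → - (c s * (y s * y s))))
      (cong₂ _+_ (sumFin-cong (λ s → *-comm (π s) (y s))) (sumFin-neg (λ s → c s * (y s * y s))))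

  cancel : ∀ a o → a + - (a + - o) ≡ o
  cancel = solve-∀

  weak-duality : ∀ π y → InBdot p y → dualObj p c π ≤∞ obj y
  weak-duality π y y∈B with phat p π | lovasz-≤ p π y y∈B
  ... | nothing | _ = tt
  ... | just a | a≤ = begin
    a + - conjugateSum π                     ≤⟨ +-mono-≤ a≤ (neg-mono-≤ gains≤) ⟩
    pairing y π + - (pairing y π + - obj y)  ≡⟨ cancel (pairing y π) (obj y) ⟩
    obj y                                    ∎
    where
    open ≤-Reasoning
    gains≤ : pairing y π + - obj y ≤ conjugateSum π
    gains≤ = subst (_≤ conjugateSum π) (gain-sum π y)
               (sumFin-mono (λ s → half-maximises (π s) (c s) (c≥1 s) (y s)))

  strong-duality : ∀ opt → dualObj p c (Certificate.π opt) ≡ just (obj (LocalOptimum.solution opt))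
  strong-duality opt = begin
    phat p π +∞ just (- conjugateSum π)
      ≡⟨ cong (_+∞ just (- conjugateSum π)) (lovasz-≡ p π x (proj₁ inB) levels-tight) ⟩
    just (pairing x π + - conjugateSum π)
      ≡⟨ cong (λ t → just (pairing x π + - t)) conjugates ⟩
    just (pairing x π + - (pairing x π + - obj x))
      ≡⟨ cong just (cancel (pairing x π) (obj x)) ⟩
    just (obj x)
      ∎
    where
    open ≡-Reasoning
    open LocalOptimum opt renaming (solution to x)
    open Certificate opt
    conjugates : conjugateSum π ≡ pairing x π + - obj x
    conjugates = trans (sumFin-cong (λ s → half-value (π s) (c s) (x s) (c≥1 s) (π-lower s) (π-upper s)))
                       (gain-sum π x)

  locally-optimal-is-optimal : ∀ opt y → InBdot p y → obj (LocalOptimum.solution opt) ≤ obj y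
  locally-optimal-is-optimal opt y y∈B =
    subst (_≤∞ obj y) (strong-duality opt) (weak-duality (Certificate.π opt) y y∈B)

-- The theorem: a local optimum and its dual certificate attain the min–max
-- equality.
theorem7p3 : (m : ℕ) (p : Subset (suc m) → ℤ∞) → Supermodular p →
    p ⊥ ≡ just (+ 0) → (∃ λ a → p ⊤ ≡ just a) →
    (∃ λ x → InBdot p x) →
    (c : Fin (suc m) → ℤ) → (∀ s → + 1 ≤ c s) →
    ∃ λ x → ∃ λ π →
      InBdot p x × (∀ y → InBdot p y → primalObj c x ≤ primalObj c y) ×
      dualObj p c π ≡ just (primalObj c x) ×
      (∀ π′ → dualObj p c π′ ≤∞ primalObj c x)
theorem7p3 m p super p⊥ _ (x₀ , x₀∈B) c c≥1 =
  solution , Certificate.π opt , inB , locally-optimal-is-optimal opt , strong-duality opt ,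
  (λ π′ → weak-duality π′ solution inB)
  where
  open MinMax p super p⊥ c c≥1
  opt : LocalOptimum
  opt = localOptimum x₀ x₀∈B
  open LocalOptimum opt
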